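{- Let $n\geq 2$. For $\alpha=(a_1,\dots,a_{n-1})\in PF_{n-1}$, define $\Psi(\alpha)=(\psi(a_1),\dots,\psi(a_{n-1}),n)$, where $\psi(a_i)=n+1-a_i$. Then $\Psi$ is a bijection from $PF_{n-1}$ onto $PF_{n,n-1}^*$.
   Context: $PF_m$ denotes the set of classical parking functions of length $m$: tuples $(a_1,\dots,a_m)\in\{1,\dots,m\}^m$ such that, when cars $c_1,\dots,c_m$ arrive in order at spots $1,\dots,m$ (west to east) and each $c_i$ parks in the first empty spot among $a_i,\dots,m$, all cars park. For integers $k\geq0$, $PF_{n,k}$ is the set of $k$-Naples parking functions of length $n$: tuples $(b_1,\dots,b_n)\in\{1,\dots,n\}^n$ under which all cars park with the rule: $c_i$ parks at $b_i$ if empty; otherwise it checks the spots $b_i-1,\dots,b_i-k$ lying in $\{1,\dots,n\}$, one at a time in this order, and parks in the first empty one; if all are occupied it parks in the first empty spot among $b_i+1,\dots,n$, failing if none. $PF_{n,k}^*=PF_{n,k}\setminus PF_{n,k-1}$ for $k\geq1$. -}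

module Defs where

open import Data.Nat using (ℕ; zero; suc; _+_; _∸_; _≤_; _<ᵇ_)
open import Data.Bool using (Bool; true; false; if_then_else_; not; T)
open import Data.List using (List; []; _∷_; _++_; replicate)
open import Data.Maybe using (Maybe; just; nothing; is-just)
open import Data.Vec using (Vec; toList; map; _∷ʳ_)
open import Data.Vec.Relation.Unary.All using (All)
open import Data.Product using (_×_)
open import Relation.Nullary using (¬_)

-- Occupancy of the street: a list of Booleans, entry i (0-based) = spot i+1,
-- true = occupied.

-- Is spot s (1-based) occupied?  Spots outside the list count as occupied.
occupied : List Bool → ℕ → Bool
occupied []       _             = true
occupied (o ∷ os) zero          = true
occupied (o ∷ os) (suc zero)    = o
occupied (o ∷ os) (suc (suc s)) = occupied os (suc s)

occupy : List Bool → ℕ → List Bool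
occupy []       _             = []
occupy (o ∷ os) zero          = o ∷ os
occupy (o ∷ os) (suc zero)    = true ∷ os
occupy (o ∷ os) (suc (suc s)) = o ∷ occupy os (suc s)

parkFirst : List Bool → List ℕ → Maybe (List Bool)
parkFirst occ []       = nothing
parkFirst occ (s ∷ ss) = if occupied occ s then parkFirst occ ss else just (occupy occ s)

fromTo : ℕ → ℕ → List ℕ
fromTo b zero    = []
fromTo b (suc c) = suc b ∷ fromTo (suc b) c

forwardSpots : (n b : ℕ) → List ℕ
forwardSpots n b = fromTo b (n ∸ b)

-- Spots b-1, b-2, ..., b-k, keeping only those lying in {1,...} (i.e. j < b).
backSpotsAux : (b j k : ℕ) → List ℕ
backSpotsAux b j zero    = []
backSpotsAux b j (suc k) =
  (if j <ᵇ b then (b ∸ j) ∷ [] else []) ++ backSpotsAux b (suc j) k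

backSpots : (b k : ℕ) → List ℕ
backSpots b k = backSpotsAux b 1 k

run : (ℕ → List ℕ) → List Bool → List ℕ → Maybe (List Bool)
run rule occ []       = just occ
run rule occ (b ∷ bs) with parkFirst occ (rule b)
... | nothing   = nothing
... | just occ' = run rule occ' bs

InRange : ℕ → ℕ → Set
InRange n a = 1 ≤ a × a ≤ n

classicalSpots : ℕ → ℕ → List ℕ
classicalSpots m a = a ∷ forwardSpots m a

naplesSpots : ℕ → ℕ → ℕ → List ℕ
naplesSpots n k b = b ∷ (backSpots b k ++ forwardSpots n b)

IsPF : (m : ℕ) → Vec ℕ m → Set
IsPF m α = All (InRange m) α
         × T (is-just (run (classicalSpots m) (replicate m false) (toList α)))

IsNaplesPF : (n k : ℕ) → Vec ℕ n → Set
IsNaplesPF n k β = All (InRange n) β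
         × T (is-just (run (naplesSpots n k) (replicate n false) (toList β)))

-- β ∈ PF*_{n,k} = PF_{n,k} \ PF_{n,k-1}   (used for k ≥ 1)
IsNaplesPF* : (n k : ℕ) → Vec ℕ n → Set
IsNaplesPF* n k β = IsNaplesPF n k β × ¬ IsNaplesPF n (k ∸ 1) β

Ψ : (m : ℕ) → Vec ℕ m → Vec ℕ (suc m)
Ψ m α = map (λ a → suc (suc m) ∸ a) α ∷ʳ suc m

-- Mirror the classical street of m spots onto spots 2..n of the Naples
-- street via t ↦ ψ t, leaving spot 1 aside.  For k = m - 1, the Naples search
-- from ψ a first visits ψ a, ψ (a+1), …, ψ m = 2 -- the mirror image of the
-- classical search from a -- and only then spot 1 and beyond (naples-mirror).
-- Hence, as long as spot 1 is empty, a Naples car with preference ψ a takes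
-- the mirror of the spot a classical car with preference a takes (Mirrors,
-- mirror-step, mirror-car).  Consequences:
--  * Ψ α with α ∈ PF_m: the first m cars fill spots 2..n, and the last car
--    (preference n) cannot reach spot 1 with k = m - 1, so Ψ α ∉ PF_{n,m-1};
--    with k = m every spot is reachable, so Ψ α ∈ PF_{n,m}.
--  * Conversely, if β ∉ PF_{n,m-1}, no car may ever take spot 1 (afterwards
--    all remaining spots 2..n are reachable and everyone parks), which forces
--    the mirrored run to be a classical parking function and the last
--    preference to be n (mirror-reflect).
module Submission where

open import Defs
open import Data.Nat using (ℕ; zero; suc; _+_; _∸_; _≤_; _<_; _<ᵇ_; z≤n; s≤s; _≟_)
open import Data.Nat.Properties
open import Data.Bool using (Bool; true; false; if_then_else_; T)
open import Data.List using (List; []; _∷_; _++_; [_]; replicate; length; map)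
open import Data.List.Properties using (++-assoc; length-replicate; length-++)
open import Data.List.Relation.Unary.All using (All; []; _∷_)
import Data.List.Relation.Unary.All as All
open import Data.List.Relation.Unary.All.Properties using (++⁺; ++⁻; map⁺)
open import Data.List.Membership.Propositional using (_∈_)
open import Data.List.Relation.Unary.Any using (here; there)
open import Data.List.Membership.Propositional.Properties using (∈-++⁺ˡ; ∈-++⁺ʳ)
open import Data.Maybe using (Maybe; just; nothing; is-just)
import Data.Maybe as Maybe
open import Data.Vec using (Vec; toList; _∷ʳ_; initLast)
import Data.Vec as Vec
open import Data.Vec.Properties using (toList-map; toList-∷ʳ; length-toList; ∷ʳ-injectiveˡ)
import Data.Vec.Relation.Unary.All as VecAll
open import Data.Vec.Relation.Unary.All.Properties using (toList⁺; toList⁻)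
open import Data.Product using (_×_; Σ; _,_; proj₁; proj₂)
open import Data.Sum using (_⊎_; inj₁; inj₂)
import Data.Sum as Sum
open import Data.Empty using (⊥; ⊥-elim)
open import Data.Unit using (⊤; tt)
open import Relation.Nullary using (¬_; yes; no)
open import Relation.Binary using (tri<; tri≈; tri>)
open import Relation.Binary.PropositionalEquality hiding ([_])
open ≡-Reasoning

free : List Bool → ℕ
free []           = 0
free (true ∷ os)  = free os
free (false ∷ os) = suc (free os)

occupied-and-empty : ∀ {os s} → occupied os s ≡ true → occupied os s ≡ false → ⊥
occupied-and-empty taken empty with trans (sym taken) empty
... | ()

occupied-occupy : ∀ os s → occupied (occupy os s) s ≡ true
occupied-occupy []       s             = refl
occupied-occupy (o ∷ os) zero          = refl
occupied-occupy (o ∷ os) (suc zero)    = refl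
occupied-occupy (o ∷ os) (suc (suc s)) = occupied-occupy os (suc s)

occupied-occupy-other : ∀ os s t → t ≢ s → occupied (occupy os s) t ≡ occupied os t
occupied-occupy-other []       s             t             t≢s = refl
occupied-occupy-other (o ∷ os) zero          t             t≢s = refl
occupied-occupy-other (o ∷ os) (suc zero)    zero          t≢s = refl
occupied-occupy-other (o ∷ os) (suc zero)    (suc zero)    t≢s = ⊥-elim (t≢s refl)
occupied-occupy-other (o ∷ os) (suc zero)    (suc (suc t)) t≢s = refl
occupied-occupy-other (o ∷ os) (suc (suc s)) zero          t≢s = refl
occupied-occupy-other (o ∷ os) (suc (suc s)) (suc zero)    t≢s = refl
occupied-occupy-other (o ∷ os) (suc (suc s)) (suc (suc t)) t≢s =
  occupied-occupy-other os (suc s) (suc t) (λ t≡s → t≢s (cong suc t≡s))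

occupy-keeps-occupied : ∀ os s t → occupied os t ≡ true → occupied (occupy os s) t ≡ true
occupy-keeps-occupied os s t taken with t ≟ s
... | yes refl = occupied-occupy os s
... | no t≢s   = trans (occupied-occupy-other os s t t≢s) taken

length-occupy : ∀ os s → length (occupy os s) ≡ length os
length-occupy []       s             = refl
length-occupy (o ∷ os) zero          = refl
length-occupy (o ∷ os) (suc zero)    = refl
length-occupy (o ∷ os) (suc (suc s)) = cong suc (length-occupy os (suc s))

free-occupy : ∀ os s → occupied os s ≡ false → suc (free (occupy os s)) ≡ free os
free-occupy (false ∷ os) (suc zero)    empty = refl
free-occupy (true ∷ os)  (suc (suc s)) empty = free-occupy os (suc s) empty
free-occupy (false ∷ os) (suc (suc s)) empty = cong suc (free-occupy os (suc s) empty)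

empty-in-range : ∀ os {n s} → length os ≡ n → occupied os s ≡ false → InRange n s
empty-in-range (o ∷ os) {s = suc zero}    refl empty = s≤s z≤n , s≤s z≤n
empty-in-range (o ∷ os) {s = suc (suc s)} refl empty =
  s≤s z≤n , s≤s (proj₂ (empty-in-range os {s = suc s} refl empty))

exists-empty : ∀ os → 1 ≤ free os → Σ ℕ λ s → occupied os s ≡ false
exists-empty (false ∷ os) _ = 1 , refl
exists-empty (true ∷ os) room with exists-empty os room
... | s , empty with empty-in-range os refl empty
... | s≤s z≤n , _ = suc s , empty

free≡0⇒full : ∀ os → free os ≡ 0 → ∀ t → occupied os t ≡ true
free≡0⇒full []          _ t             = refl
free≡0⇒full (true ∷ os) f zero          = refl
free≡0⇒full (true ∷ os) f (suc zero)    = refl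
free≡0⇒full (true ∷ os) f (suc (suc t)) = free≡0⇒full os f (suc t)

free-replicate : ∀ n → free (replicate n false) ≡ n
free-replicate zero    = refl
free-replicate (suc n) = cong suc (free-replicate n)

occupied-replicate : ∀ n {s} → InRange n s → occupied (replicate n false) s ≡ false
occupied-replicate (suc n) {suc zero}    _              = refl
occupied-replicate (suc n) {suc (suc s)} (_ , s≤s s≤n) = occupied-replicate n (s≤s z≤n , s≤n)

firstEmpty : List Bool → List ℕ → Maybe ℕ
firstEmpty os []       = nothing
firstEmpty os (s ∷ ss) = if occupied os s then firstEmpty os ss else just s

parkFirst-firstEmpty : ∀ os ss → parkFirst os ss ≡ Maybe.map (occupy os) (firstEmpty os ss)
parkFirst-firstEmpty os []       = refl
parkFirst-firstEmpty os (s ∷ ss) with occupied os s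
... | true  = parkFirst-firstEmpty os ss
... | false = refl

firstEmpty-head : ∀ os {s} ss → occupied os s ≡ false → firstEmpty os (s ∷ ss) ≡ just s
firstEmpty-head os ss empty rewrite empty = refl

firstEmpty-empty : ∀ os ss {s} → firstEmpty os ss ≡ just s → occupied os s ≡ false
firstEmpty-empty os (t ∷ ss) found with occupied os t in taken
... | true  = firstEmpty-empty os ss found
firstEmpty-empty os (t ∷ ss) refl | false = taken

firstEmpty-nothing : ∀ os ss → firstEmpty os ss ≡ nothing → All (λ t → occupied os t ≡ true) ss
firstEmpty-nothing os []       _     = []
firstEmpty-nothing os (t ∷ ss) stuck with occupied os t in taken
... | true = taken ∷ firstEmpty-nothing os ss stuck

firstEmpty-skip : ∀ os xs ys → All (λ t → occupied os t ≡ true) xs → firstEmpty os (xs ++ ys) ≡ firstEmpty os ys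
firstEmpty-skip os []       ys []               = refl
firstEmpty-skip os (t ∷ xs) ys (taken ∷ takens) rewrite taken = firstEmpty-skip os xs ys takens

firstEmpty-prefix : ∀ os xs ys {s} → firstEmpty os xs ≡ just s → firstEmpty os (xs ++ ys) ≡ just s
firstEmpty-prefix os (t ∷ xs) ys found with occupied os t
... | true  = firstEmpty-prefix os xs ys found
... | false = found

firstEmpty-map : ∀ os S (g : ℕ → ℕ) ss → All (λ t → occupied S (g t) ≡ occupied os t) ss →
                 firstEmpty S (map g ss) ≡ Maybe.map g (firstEmpty os ss)
firstEmpty-map os S g []       []          = refl
firstEmpty-map os S g (t ∷ ss) (same ∷ sames) rewrite same with occupied os t
... | true  = firstEmpty-map os S g ss sames
... | false = refl

firstEmpty-∈ : ∀ os ss {t} → t ∈ ss → occupied os t ≡ false → Σ ℕ λ s → firstEmpty os ss ≡ just s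
firstEmpty-∈ os (u ∷ ss) (here refl) empty = u , firstEmpty-head os ss empty
firstEmpty-∈ os (u ∷ ss) (there t∈) empty with occupied os u
... | true  = firstEmpty-∈ os ss t∈ empty
... | false = u , refl

Parks : (ℕ → List ℕ) → List Bool → List ℕ → Set
Parks rule os bs = T (is-just (run rule os bs))

parks-via : ∀ {r r' : Maybe (List Bool)} → r ≡ r' → T (is-just r') → T (is-just r)
parks-via refl parks = parks

parked : ∀ {r : Maybe (List Bool)} → T (is-just r) → Σ (List Bool) λ os → r ≡ just os
parked {just os} _ = os , refl

run-park : ∀ rule os b bs {s} → firstEmpty os (rule b) ≡ just s →
           run rule os (b ∷ bs) ≡ run rule (occupy os s) bs
run-park rule os b bs found rewrite parkFirst-firstEmpty os (rule b) | found = refl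

run-stuck : ∀ rule os b bs → firstEmpty os (rule b) ≡ nothing → run rule os (b ∷ bs) ≡ nothing
run-stuck rule os b bs stuck rewrite parkFirst-firstEmpty os (rule b) | stuck = refl

run-first-car : ∀ rule os b bs {os'} → run rule os (b ∷ bs) ≡ just os' →
  Σ ℕ λ s → firstEmpty os (rule b) ≡ just s × run rule (occupy os s) bs ≡ just os'
run-first-car rule os b bs done with firstEmpty os (rule b) in found
... | just s  = s , refl , trans (sym (run-park rule os b bs found)) done
... | nothing with trans (sym (run-stuck rule os b bs found)) done
...   | ()

run-++ : ∀ rule os xs ys {os'} → run rule os xs ≡ just os' → run rule os (xs ++ ys) ≡ run rule os' ys
run-++ rule os []       ys refl = refl
run-++ rule os (x ∷ xs) ys done with run-first-car rule os x xs done
... | s , found , rest = trans (run-park rule os x (xs ++ ys) found) (run-++ rule (occupy os s) xs ys rest)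

run-free : ∀ rule os bs {os'} → run rule os bs ≡ just os' → free os' + length bs ≡ free os
run-free rule os []       refl = +-identityʳ (free os)
run-free rule os (b ∷ bs) {os'} done with run-first-car rule os b bs done
... | s , found , rest = begin
  free os' + suc (length bs)        ≡⟨ +-suc (free os') (length bs) ⟩
  suc (free os' + length bs)        ≡⟨ cong suc (run-free rule (occupy os s) bs rest) ⟩
  suc (free (occupy os s))          ≡⟨ free-occupy os s (firstEmpty-empty os (rule b) found) ⟩
  free os                           ∎

parks-when-reachable : ∀ n rule (P : List Bool → Set) →
  (∀ {os b s} → P os → InRange n b → InRange n s → occupied os s ≡ false → s ∈ rule b) →
  (∀ {os} s → P os → P (occupy os s)) →
  ∀ {os} bs → P os → length os ≡ n → All (InRange n) bs → length bs ≤ free os → Parks rule os bs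
parks-when-reachable n rule P reach keep []       _ _   _          _    = tt
parks-when-reachable n rule P reach keep {os} (b ∷ bs) p len (b∈ ∷ bs∈) room
  with exists-empty os (≤-trans (s≤s z≤n) room)
... | t , t-empty with firstEmpty-∈ os (rule b) (reach p b∈ (empty-in-range os len t-empty) t-empty) t-empty
... | s , found = parks-via (run-park rule os b bs found)
        (parks-when-reachable n rule P reach keep bs (keep s p) (trans (length-occupy os s) len) bs∈ room′)
  where
  room′ : length bs ≤ free (occupy os s)
  room′ = ≤-pred (subst (suc (length bs) ≤_) (sym (free-occupy os s (firstEmpty-empty os (rule b) found))) room)

fromTo-∈ : ∀ b c t → b < t → t ≤ b + c → t ∈ fromTo b c
fromTo-∈ b zero    t b<t t≤b = ⊥-elim (<⇒≱ b<t (≤-trans t≤b (≤-reflexive (+-identityʳ b))))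
fromTo-∈ b (suc c) t b<t t≤b+c with t ≟ suc b
... | yes refl = here refl
... | no t≢1+b = there (fromTo-∈ (suc b) c t (≤∧≢⇒< b<t (λ e → t≢1+b (sym e)))
                                              (≤-trans t≤b+c (≤-reflexive (+-suc b c))))

fromTo-∈⁻ : ∀ b c {t} → t ∈ fromTo b c → b < t × t ≤ b + c
fromTo-∈⁻ b (suc c) (here refl) = ≤-refl , ≤-trans (s≤s (m≤m+n b c)) (≤-reflexive (sym (+-suc b c)))
fromTo-∈⁻ b (suc c) (there t∈) with fromTo-∈⁻ (suc b) c t∈
... | 1+b<t , t≤ = <-trans (n<1+n b) 1+b<t , ≤-trans t≤ (≤-reflexive (sym (+-suc b c)))

classical-reach : ∀ m {a t} → a ≤ t → t ≤ m → t ∈ classicalSpots m a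
classical-reach m {a} {t} a≤t t≤m with t ≟ a
... | yes refl = here refl
... | no t≢a   = there (fromTo-∈ a (m ∸ a) t (≤∧≢⇒< a≤t (λ e → t≢a (sym e)))
                                             (≤-trans t≤m (≤-reflexive (sym (m+[n∸m]≡n (≤-trans a≤t t≤m))))))

classical-∈⁻ : ∀ m {a t} → InRange m a → t ∈ classicalSpots m a → InRange m t
classical-∈⁻ m a∈ (here refl) = a∈
classical-∈⁻ m {a} (1≤a , a≤m) (there t∈) with fromTo-∈⁻ a (m ∸ a) t∈
... | a<t , t≤ = ≤-trans 1≤a (<⇒≤ a<t) , ≤-trans t≤ (≤-reflexive (m+[n∸m]≡n a≤m))

backSpotsAux-step : ∀ b j k → j < b → backSpotsAux b j (suc k) ≡ (b ∸ j) ∷ backSpotsAux b (suc j) k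
backSpotsAux-step b j k j<b with j <ᵇ b | <⇒<ᵇ j<b
... | true | _ = refl

backSpotsAux-∈ : ∀ b s k j → 1 ≤ s → s ≤ b → j ≤ b ∸ s → b ∸ s < j + k → s ∈ backSpotsAux b j k
backSpotsAux-∈ b s zero    j 1≤s s≤b j≤ <j = ⊥-elim (<⇒≱ <j (≤-trans (≤-reflexive (+-identityʳ j)) j≤))
backSpotsAux-∈ b s (suc k) j 1≤s s≤b j≤ <j with j ≟ b ∸ s
... | yes refl rewrite backSpotsAux-step b (b ∸ s) k (∸-monoʳ-< 1≤s s≤b) = here (sym (m∸[m∸n]≡n s≤b))
... | no j≢    = ∈-++⁺ʳ _ (backSpotsAux-∈ b s k (suc j) 1≤s s≤b (≤∧≢⇒< j≤ j≢)
                                          (≤-trans <j (≤-reflexive (+-suc j k))))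

naples-reach : ∀ N k {b s} → InRange N b → InRange N s → b ∸ s ≤ k → s ∈ naplesSpots N k b
naples-reach N k {b} {s} (1≤b , b≤N) (1≤s , s≤N) b∸s≤k with <-cmp s b
... | tri< s<b _ _    = there (∈-++⁺ˡ (backSpotsAux-∈ b s k 1 1≤s (<⇒≤ s<b) (m<n⇒0<n∸m s<b) (s≤s b∸s≤k)))
... | tri≈ _ refl _   = here refl
... | tri> _ _ b<s    = there (∈-++⁺ʳ _ (fromTo-∈ b (N ∸ b) s b<s (≤-trans s≤N (≤-reflexive (sym (m+[n∸m]≡n b≤N))))))

-- With k = N - 1 every spot is within reach, so any N in-range preferences park.
naples-full-reach-parks : ∀ N bs → All (InRange N) bs → length bs ≤ N →
                          Parks (naplesSpots N (N ∸ 1)) (replicate N false) bs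
naples-full-reach-parks N bs bs∈ len =
  parks-when-reachable N (naplesSpots N (N ∸ 1)) (λ _ → ⊤) (λ {os} → reach {os}) (λ {_} _ _ → tt) bs tt
    (length-replicate N) bs∈ (≤-trans len (≤-reflexive (sym (free-replicate N))))
  where
  reach : ∀ {os : List Bool} {b s} → ⊤ → InRange N b → InRange N s → occupied os s ≡ false → s ∈ naplesSpots N (N ∸ 1) b
  reach _ b∈ s∈ _ = naples-reach N (N ∸ 1) b∈ s∈ (∸-mono (proj₂ b∈) (proj₁ s∈))

-- The mirror t ↦ (m + 2) - t, exchanging the classical spots 1..m with the Naples spots n..2.
ψ : ℕ → ℕ → ℕ
ψ m t = suc (suc m) ∸ t

ψ-unfold : ∀ m {a} → a ≤ m → ψ m a ≡ suc (suc (m ∸ a))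
ψ-unfold m a≤m = +-∸-assoc 2 a≤m

ψ-involutive : ∀ m {t} → t ≤ suc (suc m) → ψ m (ψ m t) ≡ t
ψ-involutive m t≤ = m∸[m∸n]≡n t≤

ψ-map-involutive : ∀ m {k} {v : Vec ℕ k} → VecAll.All (λ t → t ≤ suc (suc m)) v →
                   Vec.map (ψ m) (Vec.map (ψ m) v) ≡ v
ψ-map-involutive m VecAll.[]             = refl
ψ-map-involutive m (t≤ VecAll.∷ v≤) = cong₂ Vec._∷_ (ψ-involutive m t≤) (ψ-map-involutive m v≤)

backSpotsAux-fromTo : ∀ b i c k → i + c < b →
  backSpotsAux b (suc i) (c + k) ≡ map (b ∸_) (fromTo i c) ++ backSpotsAux b (suc i + c) k
backSpotsAux-fromTo b i zero    k _ rewrite +-identityʳ i = refl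
backSpotsAux-fromTo b i (suc c) k i+[1+c]<b
  with i+1+c<b ← ≤-<-trans (≤-reflexive (sym (+-suc i c))) i+[1+c]<b
  rewrite backSpotsAux-step b (suc i) (c + k) (≤-<-trans (s≤s (m≤m+n i c)) i+1+c<b)
        | backSpotsAux-fromTo b (suc i) c k i+1+c<b
        | +-suc i c = refl

map-∸-fromTo : ∀ N a i c → map (N ∸_) (fromTo (a + i) c) ≡ map ((N ∸ a) ∸_) (fromTo i c)
map-∸-fromTo N a i zero    = refl
map-∸-fromTo N a i (suc c) rewrite sym (+-suc a i) =
  cong₂ _∷_ (sym (∸-+-assoc N a (suc i))) (map-∸-fromTo N a (suc i) c)

-- What an (m-1)-Naples car preferring ψ a considers after the mirror image of
-- the classical candidates of a.
naplesFallback : ℕ → ℕ → List ℕ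
naplesFallback m a = backSpotsAux (ψ m a) (suc (m ∸ a)) (a ∸ 1) ++ forwardSpots (suc m) (ψ m a)

naples-mirror : ∀ m {a} → InRange m a →
  naplesSpots (suc m) (m ∸ 1) (ψ m a) ≡ map (ψ m) (classicalSpots m a) ++ naplesFallback m a
naples-mirror m {a} (1≤a , a≤m) = cong (b ∷_) (begin
    backSpotsAux b 1 (m ∸ 1) ++ F
  ≡⟨ cong (λ k → backSpotsAux b 1 k ++ F) m-1≡c+[a-1] ⟩
    backSpotsAux b 1 (c + (a ∸ 1)) ++ F
  ≡⟨ cong (_++ F) (backSpotsAux-fromTo b 0 c (a ∸ 1) c<b) ⟩
    (map (b ∸_) (fromTo 0 c) ++ backSpotsAux b (suc c) (a ∸ 1)) ++ F
  ≡⟨ ++-assoc (map (b ∸_) (fromTo 0 c)) _ F ⟩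
    map (b ∸_) (fromTo 0 c) ++ (backSpotsAux b (suc c) (a ∸ 1) ++ F)
  ≡⟨ cong (_++ naplesFallback m a) (sym (map-∸-fromTo N a 0 c)) ⟩
    map (N ∸_) (fromTo (a + 0) c) ++ naplesFallback m a
  ≡⟨ cong (λ x → map (N ∸_) (fromTo x c) ++ naplesFallback m a) (+-identityʳ a) ⟩
    map (N ∸_) (fromTo a c) ++ naplesFallback m a
  ∎)
  where
  N = suc (suc m)
  b = ψ m a
  c = m ∸ a
  F = forwardSpots (suc m) b
  m-1≡c+[a-1] : m ∸ 1 ≡ c + (a ∸ 1)
  m-1≡c+[a-1] = trans (cong (_∸ 1) (sym (m∸n+n≡m a≤m))) (+-∸-assoc c 1≤a)
  c<b : c < b
  c<b = ≤-trans (s≤s (n≤1+n c)) (≤-reflexive (sym (ψ-unfold m a≤m)))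

naplesFallback-1 : ∀ m → naplesFallback m 1 ≡ []
naplesFallback-1 m rewrite n∸n≡0 m = refl

naplesFallback-≥2 : ∀ m {a} → 2 ≤ a → a ≤ m → Σ (List ℕ) λ r → naplesFallback m a ≡ 1 ∷ r
naplesFallback-≥2 m {suc (suc a)} _ a≤m rewrite ψ-unfold m a≤m =
  _ , cong (_++ forwardSpots (suc m) (suc (suc c)))
           (trans (backSpotsAux-step (suc (suc c)) (suc c) a ≤-refl)
                  (cong (_∷ backSpotsAux (suc (suc c)) (suc (suc c)) a) (m+n∸n≡m 1 c)))
  where c = m ∸ suc (suc a)
naplesFallback-≥2 m {suc zero} (s≤s ()) _

module Mirror (m : ℕ) (1≤m : 1 ≤ m) where

  n : ℕ
  n = suc m

  classical : ℕ → List ℕ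
  classical = classicalSpots m

  naples : ℕ → List ℕ
  naples = naplesSpots n (m ∸ 1)

  ≤n⇒≤m+2 : ∀ {t} → t ≤ n → t ≤ suc n
  ≤n⇒≤m+2 = m≤n⇒m≤1+n

  ≤m⇒≤m+2 : ∀ {t} → t ≤ m → t ≤ suc n
  ≤m⇒≤m+2 t≤m = ≤n⇒≤m+2 (m≤n⇒m≤1+n t≤m)

  ψ-range : ∀ {t} → InRange m t → 2 ≤ ψ m t × ψ m t ≤ n
  ψ-range (1≤t , t≤m) rewrite ψ-unfold m t≤m = s≤s (s≤s z≤n) , s≤s (∸-monoʳ-< 1≤t t≤m)

  ψ-in-range : ∀ {t} → InRange m t → InRange n (ψ m t)
  ψ-in-range t∈ = let (2≤ψt , ψt≤n) = ψ-range t∈ in ≤-trans (s≤s z≤n) 2≤ψt , ψt≤n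

  ψ-range⁻ : ∀ {b} → 2 ≤ b → b ≤ n → InRange m (ψ m b)
  ψ-range⁻ 2≤b b≤n = m<n⇒0<n∸m (s≤s b≤n) , ∸-monoʳ-≤ (suc (suc m)) 2≤b

  ψ-injective : ∀ {t u} → InRange m t → InRange m u → ψ m t ≡ ψ m u → t ≡ u
  ψ-injective {t} {u} (_ , t≤m) (_ , u≤m) eq = begin
    t             ≡⟨ sym (ψ-involutive m (≤m⇒≤m+2 t≤m)) ⟩
    ψ m (ψ m t)   ≡⟨ cong (ψ m) eq ⟩
    ψ m (ψ m u)   ≡⟨ ψ-involutive m (≤m⇒≤m+2 u≤m) ⟩
    u             ∎

  record Mirrors (os S : List Bool) : Set where
    field
      length-classical : length os ≡ m
      length-naples    : length S ≡ n
      free-naples      : free S ≡ suc (free os)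
      spot1-empty      : occupied S 1 ≡ false
      reflects         : ∀ {t} → InRange m t → occupied S (ψ m t) ≡ occupied os t
  open Mirrors

  mirror-init : Mirrors (replicate m false) (replicate n false)
  mirror-init = record
    { length-classical = length-replicate m
    ; length-naples    = length-replicate n
    ; free-naples      = trans (free-replicate n) (cong suc (sym (free-replicate m)))
    ; spot1-empty      = refl
    ; reflects         = λ t∈ → let (2≤ψt , ψt≤n) = ψ-range t∈ in
        trans (occupied-replicate n (≤-trans (s≤s z≤n) 2≤ψt , ψt≤n)) (sym (occupied-replicate m t∈))
    }

  mirror-step : ∀ {os S s} → Mirrors os S → occupied os s ≡ false → Mirrors (occupy os s) (occupy S (ψ m s))
  mirror-step {os} {S} {s} M empty = record
    { length-classical = trans (length-occupy os s) (length-classical M)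
    ; length-naples    = trans (length-occupy S (ψ m s)) (length-naples M)
    ; free-naples      = suc-injective (begin
        suc (free (occupy S (ψ m s)))   ≡⟨ free-occupy S (ψ m s) ψs-empty ⟩
        free S                          ≡⟨ free-naples M ⟩
        suc (free os)                   ≡⟨ cong suc (sym (free-occupy os s empty)) ⟩
        suc (suc (free (occupy os s)))  ∎)
    ; spot1-empty      = trans (occupied-occupy-other S (ψ m s) 1 1≢ψs) (spot1-empty M)
    ; reflects         = reflects′
    }
    where
    s∈ : InRange m s
    s∈ = empty-in-range os (length-classical M) empty
    ψs-empty : occupied S (ψ m s) ≡ false
    ψs-empty = trans (reflects M s∈) empty
    1≢ψs : 1 ≢ ψ m s
    1≢ψs 1≡ψs = <⇒≱ (proj₁ (ψ-range s∈)) (≤-reflexive (sym 1≡ψs))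
    reflects′ : ∀ {t} → InRange m t → occupied (occupy S (ψ m s)) (ψ m t) ≡ occupied (occupy os s) t
    reflects′ {t} t∈ with t ≟ s
    ... | yes refl = trans (occupied-occupy S (ψ m s)) (sym (occupied-occupy os s))
    ... | no t≢s   = begin
      occupied (occupy S (ψ m s)) (ψ m t) ≡⟨ occupied-occupy-other S (ψ m s) (ψ m t) (λ e → t≢s (ψ-injective t∈ s∈ e)) ⟩
      occupied S (ψ m t)                  ≡⟨ reflects M t∈ ⟩
      occupied os t                       ≡⟨ sym (occupied-occupy-other os s t t≢s) ⟩
      occupied (occupy os s) t            ∎

  mirror-occupied : ∀ {os S a} → Mirrors os S → InRange m a →
    All (λ t → occupied os t ≡ true) (classical a) → All (λ t → occupied S t ≡ true) (map (ψ m) (classical a))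
  mirror-occupied M a∈ takens =
    map⁺ (All.zipWith (λ (t∈ , taken) → trans (reflects M t∈) taken)
                      (All.tabulate (classical-∈⁻ m a∈) , takens))

  mirror-car : ∀ {os S a s} → Mirrors os S → InRange m a →
    firstEmpty os (classical a) ≡ just s → firstEmpty S (naples (ψ m a)) ≡ just (ψ m s)
  mirror-car {os} {S} {a} {s} M a∈ found = begin
    firstEmpty S (naples (ψ m a))
      ≡⟨ cong (firstEmpty S) (naples-mirror m a∈) ⟩
    firstEmpty S (map (ψ m) (classical a) ++ naplesFallback m a)
      ≡⟨ firstEmpty-prefix S (map (ψ m) (classical a)) (naplesFallback m a) (begin
           firstEmpty S (map (ψ m) (classical a))
             ≡⟨ firstEmpty-map os S (ψ m) (classical a) (All.tabulate (λ t∈ → reflects M (classical-∈⁻ m a∈ t∈))) ⟩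
           Maybe.map (ψ m) (firstEmpty os (classical a))
             ≡⟨ cong (Maybe.map (ψ m)) found ⟩
           just (ψ m s) ∎) ⟩
    just (ψ m s)
      ∎

  mirror-car-stuck : ∀ {os S a} → Mirrors os S → InRange m a → 2 ≤ a →
    firstEmpty os (classical a) ≡ nothing → firstEmpty S (naples (ψ m a)) ≡ just 1
  mirror-car-stuck {os} {S} {a} M a∈ 2≤a stuck with naplesFallback-≥2 m 2≤a (proj₂ a∈)
  ... | r , fallback≡1∷r = begin
    firstEmpty S (naples (ψ m a))
      ≡⟨ cong (firstEmpty S) (naples-mirror m a∈) ⟩
    firstEmpty S (map (ψ m) (classical a) ++ naplesFallback m a)
      ≡⟨ firstEmpty-skip S _ _ (mirror-occupied M a∈ (firstEmpty-nothing os (classical a) stuck)) ⟩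
    firstEmpty S (naplesFallback m a)  ≡⟨ cong (firstEmpty S) fallback≡1∷r ⟩
    firstEmpty S (1 ∷ r)               ≡⟨ firstEmpty-head S r (spot1-empty M) ⟩
    just 1                             ∎

  mirror-full-blocks-n : ∀ {os S} → Mirrors os S → free os ≡ 0 → firstEmpty S (naples n) ≡ nothing
  mirror-full-blocks-n {os} {S} M full = begin
    firstEmpty S (naples (ψ m 1))                               ≡⟨ cong (firstEmpty S) (naples-mirror m 1∈) ⟩
    firstEmpty S (map (ψ m) (classical 1) ++ naplesFallback m 1)
      ≡⟨ firstEmpty-skip S _ _ (mirror-occupied M 1∈ (All.tabulate (λ {t} _ → free≡0⇒full os full t))) ⟩
    firstEmpty S (naplesFallback m 1)                           ≡⟨ cong (firstEmpty S) (naplesFallback-1 m) ⟩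
    nothing                                                     ∎
    where
    1∈ : InRange m 1
    1∈ = ≤-refl , 1≤m

  mirror-run : ∀ as {os S os'} → Mirrors os S → All (InRange m) as → run classical os as ≡ just os' →
    Σ (List Bool) λ S' → run naples S (map (ψ m) as) ≡ just S' × Mirrors os' S'
  mirror-run []       M []          refl = _ , refl , M
  mirror-run (a ∷ as) {os} {S} M (a∈ ∷ as∈) done with run-first-car classical os a as done
  ... | s , found , rest with mirror-run as (mirror-step M (firstEmpty-empty os (classical a) found)) as∈ rest
  ... | S' , done′ , M′ = S' , trans (run-park naples S (ψ m a) (map (ψ m) as) (mirror-car M a∈ found)) done′ , M′

  -- Once spot 1 is taken every remaining empty spot s ≥ 2 satisfies b - s ≤ m - 1,
  -- so all remaining cars park.
  parks-once-spot1-taken : ∀ {S} bs → occupied S 1 ≡ true → length S ≡ n →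
    All (InRange n) bs → length bs ≤ free S → Parks naples S bs
  parks-once-spot1-taken =
    parks-when-reachable n naples (λ S → occupied S 1 ≡ true) (λ {S} → reach {S})
      (λ {S} s taken → occupy-keeps-occupied S s 1 taken)
    where
    reach : ∀ {S b s} → occupied S 1 ≡ true → InRange n b → InRange n s → occupied S s ≡ false → s ∈ naples b
    reach {S} {s = suc zero} taken _ _ empty = ⊥-elim (occupied-and-empty {S} {1} taken empty)
    reach {s = suc (suc s)} _ b∈ s∈ _       = naples-reach n (m ∸ 1) b∈ s∈ (∸-mono (proj₂ b∈) (s≤s (s≤s z≤n)))

  taking-spot1-parks : ∀ {os S} b bs → Mirrors os S → length bs ≤ free os → All (InRange n) bs →
    firstEmpty S (naples b) ≡ just 1 → Parks naples S (b ∷ bs)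
  taking-spot1-parks {os} {S} b bs M room bs∈ takes-1 =
    parks-via (run-park naples S b bs takes-1)
      (parks-once-spot1-taken bs (occupied-occupy S 1) (trans (length-occupy S 1) (length-naples M)) bs∈
        (≤-trans room (≤-reflexive (suc-injective (begin
          suc (free os)            ≡⟨ sym (free-naples M) ⟩
          free S                   ≡⟨ sym (free-occupy S 1 (spot1-empty M)) ⟩
          suc (free (occupy S 1))  ∎)))))

  -- On a street with an empty spot the classical car preferring 1 always parks,
  -- so a classical car that fails prefers some a ≥ 2.
  classical-stuck⇒2≤ : ∀ {os a} → length os ≡ m → 1 ≤ free os → InRange m a →
    firstEmpty os (classical a) ≡ nothing → 2 ≤ a
  classical-stuck⇒2≤ {os} {a} len room (1≤a , _) stuck with a ≟ 1
  ... | no a≢1 = ≤∧≢⇒< 1≤a (λ e → a≢1 (sym e))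
  ... | yes refl with exists-empty os room
  ...   | t , empty with empty-in-range os len empty
  ...   | 1≤t , t≤m with firstEmpty-∈ os (classical 1) (classical-reach m 1≤t t≤m) empty
  ...   | s , found with trans (sym found) stuck
  ...     | ()

  mirrored-car : ∀ {os S a} → Mirrors os S → 1 ≤ free os → InRange m a →
    firstEmpty S (naples (ψ m a)) ≡ just 1 ⊎
    Σ ℕ λ s → firstEmpty os (classical a) ≡ just s × firstEmpty S (naples (ψ m a)) ≡ just (ψ m s)
  mirrored-car {os} {a = a} M room a∈ with firstEmpty os (classical a) in found
  ... | just s  = inj₂ (s , refl , mirror-car M a∈ found)
  ... | nothing = inj₁ (mirror-car-stuck M a∈ (classical-stuck⇒2≤ (length-classical M) room a∈ found) found)

  -- The same for an arbitrary Naples preference b: preference 1 takes spot 1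
  -- directly, and b ≥ 2 is ψ of a classical preference.
  naples-car : ∀ {os S b} → Mirrors os S → 1 ≤ free os → InRange n b →
    firstEmpty S (naples b) ≡ just 1 ⊎
    Σ ℕ λ s → InRange m (ψ m b) × firstEmpty os (classical (ψ m b)) ≡ just s × firstEmpty S (naples b) ≡ just (ψ m s)
  naples-car {S = S} {b} M room (1≤b , b≤n) with b ≟ 1
  ... | yes refl = inj₁ (firstEmpty-head S (backSpots 1 (m ∸ 1) ++ forwardSpots n 1) (spot1-empty M))
  ... | no b≢1   = Sum.map unmirror (λ (s , found , takes-ψs) → s , a∈ , found , unmirror takes-ψs)
                           (mirrored-car M room a∈)
    where
    a∈ : InRange m (ψ m b)
    a∈ = ψ-range⁻ (≤∧≢⇒< 1≤b (λ e → b≢1 (sym e))) b≤n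
    unmirror : ∀ {r} → firstEmpty S (naples (ψ m (ψ m b))) ≡ r → firstEmpty S (naples b) ≡ r
    unmirror {r} = subst (λ c → firstEmpty S (naples c) ≡ r) (ψ-involutive m (≤n⇒≤m+2 b≤n))

  -- While spot 1 is empty, a last car not preferring n reaches it (b - 1 ≤ m - 1) and parks.
  last-car-is-n : ∀ {os S} bl → Mirrors os S → InRange n bl → ¬ Parks naples S [ bl ] → bl ≡ n
  last-car-is-n {S = S} bl M (1≤bl , bl≤n) fails with bl ≟ n
  ... | yes bl≡n = bl≡n
  ... | no bl≢n with firstEmpty-∈ S (naples bl)
                      (naples-reach n (m ∸ 1) (1≤bl , bl≤n) (≤-refl , s≤s z≤n)
                                    (∸-monoˡ-≤ 1 (≤-pred (≤∧≢⇒< bl≤n bl≢n))))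
                      (spot1-empty M)
  ... | s , found = ⊥-elim (fails (parks-via (run-park naples S bl [] found) tt))

  -- Backward simulation: if the Naples run of bs followed by bl fails, no car
  -- ever took spot 1, so the ψ-images of bs form a successful classical run and bl = n.
  mirror-reflect : ∀ bs bl {os S} → Mirrors os S → length bs ≤ free os →
    All (InRange n) bs → InRange n bl → ¬ Parks naples S (bs ++ [ bl ]) →
    All (InRange m) (map (ψ m) bs) × Parks classical os (map (ψ m) bs) × bl ≡ n
  mirror-reflect [] bl M _ [] bl∈ fails = [] , tt , last-car-is-n bl M bl∈ fails
  mirror-reflect (b ∷ bs) bl {os} {S} M room (b∈ ∷ bs∈) bl∈ fails
    with naples-car M (≤-trans (s≤s z≤n) room) b∈
  ... | inj₁ takes-1 =
    ⊥-elim (fails (taking-spot1-parks b (bs ++ [ bl ]) M room′ (++⁺ bs∈ (bl∈ ∷ [])) takes-1))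
    where
    room′ : length (bs ++ [ bl ]) ≤ free os
    room′ = ≤-trans (≤-reflexive (trans (length-++ bs) (+-comm (length bs) 1))) room
  ... | inj₂ (s , a∈ , classical-s , naples-ψs)
    with mirror-reflect bs bl (mirror-step M (firstEmpty-empty os (classical (ψ m b)) classical-s)) room′ bs∈ bl∈
           (λ parks → fails (parks-via (run-park naples S b _ naples-ψs) parks))
    where
    room′ : length bs ≤ free (occupy os s)
    room′ = ≤-pred (subst (suc (length bs) ≤_) (sym (free-occupy os s (firstEmpty-empty os (classical (ψ m b)) classical-s))) room)
  ... | as∈ , parks , bl≡n = a∈ ∷ as∈ , parks-via (run-park classical os (ψ m b) _ classical-s) parks , bl≡n

  toList-Ψ : (α : Vec ℕ m) → toList (Ψ m α) ≡ map (ψ m) (toList α) ++ [ n ]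
  toList-Ψ α = trans (toList-∷ʳ n (Vec.map (ψ m) α)) (cong (_++ [ n ]) (toList-map (ψ m) α))

  -- The mirrored run of a classical parking function, followed by a car
  -- preferring n, fails for k = m - 1: the first m cars fill spots 2..n and
  -- the last car cannot reach spot 1.
  mirror-then-n-fails : ∀ as → All (InRange m) as → length as ≡ m → Parks classical (replicate m false) as →
    run naples (replicate n false) (map (ψ m) as ++ [ n ]) ≡ nothing
  mirror-then-n-fails as as∈ len parks with parked parks
  ... | os' , done with mirror-run as mirror-init as∈ done
  ... | S' , done′ , M′ = begin
    run naples (replicate n false) (map (ψ m) as ++ [ n ])  ≡⟨ run-++ naples _ (map (ψ m) as) [ n ] done′ ⟩
    run naples S' [ n ]                                      ≡⟨ run-stuck naples S' n [] (mirror-full-blocks-n M′ full) ⟩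
    nothing                                                  ∎
    where
    full : free os' ≡ 0
    full = +-cancelʳ-≡ m (free os') 0 (begin
      free os' + m              ≡⟨ cong (free os' +_) (sym len) ⟩
      free os' + length as      ≡⟨ run-free classical _ as done ⟩
      free (replicate m false)  ≡⟨ free-replicate m ⟩
      m                         ∎)

  Ψ-into : (α : Vec ℕ m) → IsPF m α → IsNaplesPF* n m (Ψ m α)
  Ψ-into α (α∈ , parks) = (toList⁻ Ψα∈ , parks-with-m) , parks-not-with-m-1
    where
    Ψα∈ : All (InRange n) (toList (Ψ m α))
    Ψα∈ = subst (All (InRange n)) (sym (toList-Ψ α))
            (++⁺ (map⁺ (All.map ψ-in-range (toList⁺ α∈))) ((s≤s z≤n , ≤-refl) ∷ []))
    parks-with-m : Parks (naplesSpots n m) (replicate n false) (toList (Ψ m α))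
    parks-with-m = naples-full-reach-parks n (toList (Ψ m α)) Ψα∈ (≤-reflexive (length-toList (Ψ m α)))
    parks-not-with-m-1 : ¬ IsNaplesPF n (m ∸ 1) (Ψ m α)
    parks-not-with-m-1 (_ , parks′) =
      parks-via (sym (trans (cong (run naples (replicate n false)) (toList-Ψ α))
                            (mirror-then-n-fails (toList α) (toList⁺ α∈) (length-toList α) parks)))
                parks′

  Ψ-injective : (α α' : Vec ℕ m) → IsPF m α → IsPF m α' → Ψ m α ≡ Ψ m α' → α ≡ α'
  Ψ-injective α α' (α∈ , _) (α'∈ , _) eq = begin
    α                                  ≡⟨ sym (ψ-map-involutive m (VecAll.map (λ t∈ → ≤m⇒≤m+2 (proj₂ t∈)) α∈)) ⟩
    Vec.map (ψ m) (Vec.map (ψ m) α)    ≡⟨ cong (Vec.map (ψ m)) (∷ʳ-injectiveˡ _ _ eq) ⟩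
    Vec.map (ψ m) (Vec.map (ψ m) α')   ≡⟨ ψ-map-involutive m (VecAll.map (λ t∈ → ≤m⇒≤m+2 (proj₂ t∈)) α'∈) ⟩
    α'                                 ∎

  Ψ-onto-snoc : (ys : Vec ℕ m) (y : ℕ) → IsNaplesPF* n m (ys ∷ʳ y) →
    Σ (Vec ℕ m) (λ α → IsPF m α × Ψ m α ≡ ys ∷ʳ y)
  Ψ-onto-snoc ys y ((β∈ , _) , not-m-1)
    with ++⁻ (toList ys) (subst (All (InRange n)) (toList-∷ʳ y ys) (toList⁺ β∈))
  ... | ys∈ , (y∈ ∷ []) with mirror-reflect (toList ys) y mirror-init room ys∈ y∈ fails
    where
    room : length (toList ys) ≤ free (replicate m false)
    room = ≤-reflexive (trans (length-toList ys) (sym (free-replicate m)))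
    fails : ¬ Parks naples (replicate n false) (toList ys ++ [ y ])
    fails parks = not-m-1 (β∈ , parks-via (cong (run naples (replicate n false)) (toList-∷ʳ y ys)) parks)
  ... | α∈ , parks , y≡n =
    Vec.map (ψ m) ys ,
    (toList⁻ (subst (All (InRange m)) (sym (toList-map (ψ m) ys)) α∈) ,
     parks-via (cong (run classical (replicate m false)) (toList-map (ψ m) ys)) parks) ,
    cong₂ _∷ʳ_ (ψ-map-involutive m (toList⁻ (All.map (λ t∈ → ≤n⇒≤m+2 (proj₂ t∈)) ys∈))) (sym y≡n)

  Ψ-onto : (β : Vec ℕ n) → IsNaplesPF* n m β → Σ (Vec ℕ m) (λ α → IsPF m α × Ψ m α ≡ β)
  Ψ-onto β β∈ with initLast β
  ... | ys , y , refl = Ψ-onto-snoc ys y β∈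

theorem2p3 : (m : ℕ) → 1 ≤ m →
    ((α : Vec ℕ m) → IsPF m α → IsNaplesPF* (suc m) m (Ψ m α))
    × ((α α' : Vec ℕ m) → IsPF m α → IsPF m α' → Ψ m α ≡ Ψ m α' → α ≡ α')
    × ((β : Vec ℕ (suc m)) → IsNaplesPF* (suc m) m β →
        Σ (Vec ℕ m) (λ α → IsPF m α × Ψ m α ≡ β))
theorem2p3 m 1≤m = Ψ-into , Ψ-injective , Ψ-onto
  where open Mirror m 1≤m
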